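{- Let $D=(V,A)$ be a digraph and $v\in V$ a vertex with out-eccentricity $\max_{u\in V} d(v,u)=r'$, where $r' \ge r\ge 3$. Let $v u_1u_2\cdots u_{r'}$ be a directed path in $D$ with $d(v,u_{r'})=r'$ such that for every $i$ with $r'-r+1 \le i \le r'$ there is a vertex $x_i$ with $d(v,x_i)<d(v,u_i)+d(u_i,x_i)$ and $d(u_i,v)+d(v,x_i)\ge r$. Then $$\sum_{u \in V, u \ne v}\left(d(v,u)-1\right) + \sum_{1 \le i \le r'} \left(d(u_i,v)-1\right) \ge (r-1)^2,$$ with equality if and only if (up to labeling) all of the following hold: $r'=r$; there is a second directed path $v w_2w_3\cdots w_{r}$ with $d(v,w_{r})=r-1$ which shares no vertex with the first path other than $v$; $d(u_i,v)=1$ for every $1 \le i \le r$; and $d(v,u)=1$ for every vertex $u$ not on these two directed paths.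
   Context: $d(x,y)$ denotes the length of a shortest directed path from $x$ to $y$ in $D$. -}

module Defs where

open import Data.Nat using (ℕ; zero; suc; _+_; _∸_; _≤_; _<_)
open import Data.Fin using (Fin; _≟_)
open import Data.Product using (_×_; ∃)
open import Data.Bool using (if_then_else_)
open import Relation.Nullary using (¬_)
open import Relation.Nullary.Decidable using (⌊_⌋)
open import Relation.Binary.PropositionalEquality using (_≡_)

record Digraph : Set₁ where
  field
    n   : ℕ
    Arc : Fin n → Fin n → Set

open Digraph public

V : Digraph → Set
V D = Fin (n D)

data ℕ∞ : Set where
  fin : ℕ → ℕ∞
  ∞   : ℕ∞

_+∞_ : ℕ∞ → ℕ∞ → ℕ∞
fin a +∞ fin b = fin (a + b)
_     +∞ _     = ∞

pred∞ : ℕ∞ → ℕ∞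
pred∞ (fin a) = fin (a ∸ 1)
pred∞ ∞       = ∞

data _≤∞_ : ℕ∞ → ℕ∞ → Set where
  fin≤fin : ∀ {a b} → a ≤ b → fin a ≤∞ fin b
  _≤∞∞    : ∀ x → x ≤∞ ∞

data _<∞_ : ℕ∞ → ℕ∞ → Set where
  fin<fin : ∀ {a b} → a < b → fin a <∞ fin b
  fin<∞   : ∀ {a} → fin a <∞ ∞

data Walk (D : Digraph) : V D → V D → ℕ → Set where
  here : ∀ {x} → Walk D x x 0
  step : ∀ {x y z k} → Arc D x y → Walk D y z k → Walk D x z (suc k)

IsDistance : (D : Digraph) → V D → V D → ℕ∞ → Set
IsDistance D x y (fin k) = Walk D x y k × (∀ m → Walk D x y m → k ≤ m)
IsDistance D x y ∞       = ∀ m → ¬ Walk D x y m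

IsDistanceFunction : (D : Digraph) → (V D → V D → ℕ∞) → Set
IsDistanceFunction D d = ∀ x y → IsDistance D x y (d x y)

OutEccentricity : (D : Digraph) → (V D → V D → ℕ∞) → V D → ℕ → Set
OutEccentricity D d v r' = (∀ u → d v u ≤∞ fin r') × ∃ (λ u → d v u ≡ fin r')

sumFin : ∀ {k} → (Fin k → ℕ∞) → ℕ∞
sumFin {zero}  f = fin 0
sumFin {suc k} f = f Fin.zero +∞ sumFin (λ i → f (Fin.suc i))

sumOut : (D : Digraph) → (V D → V D → ℕ∞) → V D → ℕ∞
sumOut D d v = sumFin (λ u → if ⌊ u ≟ v ⌋ then fin 0 else pred∞ (d v u))

sum1to : ℕ → (ℕ → ℕ∞) → ℕ∞
sum1to zero    f = fin 0
sum1to (suc m) f = sum1to m f +∞ f (suc m)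

IsDirPath : (D : Digraph) → (ℕ → V D) → ℕ → Set
IsDirPath D p ℓ =
  (∀ i → i < ℓ → Arc D (p i) (p (suc i))) ×
  (∀ i j → i ≤ ℓ → j ≤ ℓ → p i ≡ p j → i ≡ j)

{-# OPTIONS --safe #-}
-- Sort the vertices by their level t = d(v, ·): a vertex of level t contributes t − 1, and
-- every level 1 … r' holds u_t.  For i > r' − r the witness x_i is not reached through u_i on a
-- shortest path, so a shortest v–x_i path avoids u at levels i … d(v, x_i) and these levels hold
-- two vertices; on the other hand d(u_i, v) − 1 ≥ r − 1 − d(v, x_i).  Hence d(u_i, v) − 1 pays
-- for the singleton levels in i … r − 1, and adding up these charges level by level gives
-- (r − 1)², with a surplus unless r' = r and d(u_1, v) = 1.  In the equality case the shortest
-- path to x_1 is the second path, and tightness forces every remaining condition.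
module Submission where

open import Defs
open import Data.Nat
  using (ℕ; zero; suc; _+_; _*_; _∸_; _≤_; _<_; z≤n; s≤s; z<s; pred; _≟_; _≤?_; _<?_; ≢-nonZero; >-nonZero)
open import Data.Nat.Properties
open import Data.Nat.Tactic.RingSolver using (solve-∀)
open import Data.Fin using (Fin) renaming (_≟_ to _≟ᶠ_)
open import Data.Bool using (if_then_else_)
open import Data.List using (List; []; _∷_; length)
open import Data.List.Relation.Unary.All using (All; []; _∷_)
import Data.List.Relation.Unary.All as All
open import Data.List.Relation.Unary.All.Properties using (¬Any⇒All¬)
open import Data.List.Relation.Unary.Any using (here; there)
open import Data.List.Relation.Unary.AllPairs using ([]; _∷_)
open import Data.List.Relation.Unary.Unique.Propositional using (Unique)
open import Data.List.Membership.Propositional using (_∈_; _∉_)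
import Data.List.Membership.DecPropositional as DecMembership
open import Data.Product using (_×_; _,_; ∃; ∃-syntax; proj₁; proj₂)
open import Data.Sum using (_⊎_; inj₁; inj₂)
open import Function using (_∘_; case_of_)
open import Function.Bundles using (_⇔_; mk⇔)
open import Relation.Nullary using (Dec; yes; no; ¬_; contradiction)
open import Relation.Nullary.Decidable using (_×-dec_; ¬?; map′; ⌊_⌋)
open import Relation.Unary using (Decidable)
open import Relation.Binary.PropositionalEquality
  using (_≡_; _≢_; refl; sym; trans; cong; cong₂; subst; subst₂; module ≡-Reasoning)
open import Algebra.Properties.CommutativeSemigroup +-commutativeSemigroup using (interchange)
open import Algebra.Properties.Semiring.Sum +-*-semiring
  using (sum; ∑-distrib-+; sum-replicate-zero; sum-cong-≗; *-distribˡ-sum)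

𝟙 : ∀ {a} {A : Set a} → Dec A → ℕ
𝟙 (yes _) = 1
𝟙 (no _)  = 0

𝟙≤1 : ∀ {a} {A : Set a} (A? : Dec A) → 𝟙 A? ≤ 1
𝟙≤1 (yes _) = s≤s z≤n
𝟙≤1 (no _)  = z≤n

rangeSum : (ℕ → ℕ) → ℕ → ℕ → ℕ
rangeSum f a zero    = 0
rangeSum f a (suc k) = f a + rangeSum f (suc a) k

infix 4 _∈[_,+_⟩
_∈[_,+_⟩ : ℕ → ℕ → ℕ → Set
t ∈[ a ,+ k ⟩ = a ≤ t × t < a + k

∈-first : ∀ {a k} → a ∈[ a ,+ suc k ⟩
∈-first {a} {k} = ≤-refl , m<m+n a z<s

∈-later : ∀ {a k t} → t ∈[ suc a ,+ k ⟩ → t ∈[ a ,+ suc k ⟩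
∈-later {a} {k} {t} (a<t , t<) = <⇒≤ a<t , subst (t <_) (sym (+-suc a k)) t<

∈-split : ∀ {a k t} → t ∈[ a ,+ suc k ⟩ → t ≡ a ⊎ t ∈[ suc a ,+ k ⟩
∈-split {a} {k} {t} (a≤t , t<) with m≤n⇒m<n∨m≡n a≤t
... | inj₂ a≡t = inj₁ (sym a≡t)
... | inj₁ a<t = inj₂ (a<t , subst (t <_) (+-suc a k) t<)

∈-init : ∀ {a k t} → t ∈[ a ,+ k ⟩ → t ∈[ a ,+ suc k ⟩
∈-init {a} {k} {t} (a≤t , t<) = a≤t , subst (t <_) (sym (+-suc a k)) (m<n⇒m<1+n t<)

∈-last : ∀ {a k} → a + k ∈[ a ,+ suc k ⟩
∈-last {a} {k} = m≤m+n a k , subst (a + k <_) (sym (+-suc a k)) ≤-refl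

∈-split-last : ∀ {a k t} → t ∈[ a ,+ suc k ⟩ → t ∈[ a ,+ k ⟩ ⊎ t ≡ a + k
∈-split-last {a} {k} {t} (a≤t , t<) with m≤n⇒m<n∨m≡n (≤-pred (subst (t <_) (+-suc a k) t<))
... | inj₁ t<a+k = inj₁ (a≤t , t<a+k)
... | inj₂ t≡a+k = inj₂ t≡a+k

∉-empty : ∀ {a t} → ¬ t ∈[ a ,+ 0 ⟩
∉-empty {a} (a≤t , t<) = <-irrefl refl (≤-trans t< (subst (_≤ _) (sym (+-identityʳ a)) a≤t))

module _ {f g : ℕ → ℕ} where

  rangeSum-mono : ∀ {a} k → (∀ {t} → t ∈[ a ,+ k ⟩ → f t ≤ g t) → rangeSum f a k ≤ rangeSum g a k
  rangeSum-mono zero    f≤g = z≤n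
  rangeSum-mono (suc k) f≤g = +-mono-≤ (f≤g ∈-first) (rangeSum-mono k (f≤g ∘ ∈-later))

  rangeSum-cong : ∀ {a} k → (∀ {t} → t ∈[ a ,+ k ⟩ → f t ≡ g t) → rangeSum f a k ≡ rangeSum g a k
  rangeSum-cong zero    f≡g = refl
  rangeSum-cong (suc k) f≡g = cong₂ _+_ (f≡g ∈-first) (rangeSum-cong k (f≡g ∘ ∈-later))

  rangeSum-< : ∀ {a t} k → (∀ {t} → t ∈[ a ,+ k ⟩ → f t ≤ g t) → t ∈[ a ,+ k ⟩ → f t < g t →
               rangeSum f a k < rangeSum g a k
  rangeSum-< zero    f≤g t∈ ft<gt = contradiction t∈ ∉-empty
  rangeSum-< (suc k) f≤g t∈ ft<gt with ∈-split t∈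
  ... | inj₁ refl = +-mono-<-≤ ft<gt (rangeSum-mono k (f≤g ∘ ∈-later))
  ... | inj₂ t∈′  = +-mono-≤-< (f≤g ∈-first) (rangeSum-< k (f≤g ∘ ∈-later) t∈′ ft<gt)

  rangeSum-distrib-+ : ∀ a k → rangeSum (λ t → f t + g t) a k ≡ rangeSum f a k + rangeSum g a k
  rangeSum-distrib-+ a zero    = refl
  rangeSum-distrib-+ a (suc k) = trans (cong (f a + g a +_) (rangeSum-distrib-+ (suc a) k))
                                       (interchange (f a) (g a) _ _)

module _ {f : ℕ → ℕ} where

  rangeSum-++ : ∀ a m n → rangeSum f a (m + n) ≡ rangeSum f a m + rangeSum f (a + m) n
  rangeSum-++ a zero    n = cong (λ b → rangeSum f b n) (sym (+-identityʳ a))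
  rangeSum-++ a (suc m) n = begin
    f a + rangeSum f (suc a) (m + n)                       ≡⟨ cong (f a +_) (rangeSum-++ (suc a) m n) ⟩
    f a + (rangeSum f (suc a) m + rangeSum f (suc a + m) n) ≡⟨ sym (+-assoc (f a) _ _) ⟩
    rangeSum f a (suc m) + rangeSum f (suc a + m) n        ≡⟨ cong (λ b → rangeSum f a (suc m) + rangeSum f b n)
                                                                   (sym (+-suc a m)) ⟩
    rangeSum f a (suc m) + rangeSum f (a + suc m) n        ∎
    where open ≡-Reasoning

  rangeSum-snoc : ∀ a k → rangeSum f a (suc k) ≡ rangeSum f a k + f (a + k)
  rangeSum-snoc a k = trans (cong (rangeSum f a) (+-comm 1 k))
                            (trans (rangeSum-++ a k 1) (cong (rangeSum f a k +_) (+-identityʳ (f (a + k)))))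

  rangeSum-zero : ∀ {a} k → (∀ {t} → t ∈[ a ,+ k ⟩ → f t ≡ 0) → rangeSum f a k ≡ 0
  rangeSum-zero zero    f≡0 = refl
  rangeSum-zero (suc k) f≡0 = cong₂ _+_ (f≡0 ∈-first) (rangeSum-zero k (f≡0 ∘ ∈-later))

  rangeSum-term : ∀ {a t} k → t ∈[ a ,+ k ⟩ → f t ≤ rangeSum f a k
  rangeSum-term zero    t∈ = contradiction t∈ ∉-empty
  rangeSum-term (suc k) t∈ with ∈-split t∈
  ... | inj₁ refl = m≤m+n _ _
  ... | inj₂ t∈′  = ≤-trans (rangeSum-term k t∈′) (m≤n+m _ _)

  rangeSum-≤-length : (∀ t → f t ≤ 1) → ∀ a k → rangeSum f a k ≤ k
  rangeSum-≤-length f≤1 a zero    = z≤n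
  rangeSum-≤-length f≤1 a (suc k) = +-mono-≤ (f≤1 a) (rangeSum-≤-length f≤1 (suc a) k)

  rangeSum-vanishing : (∀ t → f t ≤ 1) → ∀ {e} i j → (∀ t → i ≤ t → t ≤ e → f t ≡ 0) →
                       rangeSum f i j ≤ (i + j) ∸ suc e
  rangeSum-vanishing f≤1         i zero    f≡0 = z≤n
  rangeSum-vanishing f≤1 {e} i (suc j) f≡0 with i ≤? e
  ... | yes i≤e = begin
    f i + rangeSum f (suc i) j ≡⟨ cong (_+ rangeSum f (suc i) j) (f≡0 i ≤-refl i≤e) ⟩
    rangeSum f (suc i) j       ≤⟨ rangeSum-vanishing f≤1 (suc i) j (λ t i<t → f≡0 t (<⇒≤ i<t)) ⟩
    (suc i + j) ∸ suc e        ≡⟨ cong (_∸ suc e) (sym (+-suc i j)) ⟩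
    (i + suc j) ∸ suc e        ∎
    where open ≤-Reasoning
  ... | no i≰e = begin
    rangeSum f i (suc j)       ≤⟨ rangeSum-≤-length f≤1 i (suc j) ⟩
    suc j                      ≡⟨ sym (m+n∸m≡n (suc e) (suc j)) ⟩
    (suc e + suc j) ∸ suc e    ≤⟨ ∸-monoˡ-≤ (suc e) (+-monoˡ-≤ (suc j) (≰⇒> i≰e)) ⟩
    (i + suc j) ∸ suc e        ∎
    where open ≤-Reasoning

𝟙-yes : ∀ {a} {A : Set a} → A → (A? : Dec A) → 𝟙 A? ≡ 1
𝟙-yes x (yes _) = refl
𝟙-yes x (no ¬x) = contradiction x ¬x

𝟙-no : ∀ {a} {A : Set a} → ¬ A → (A? : Dec A) → 𝟙 A? ≡ 0
𝟙-no ¬x (yes x) = contradiction x ¬x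
𝟙-no ¬x (no _)  = refl

module _ (f : ℕ → ℕ) (m : ℕ) where

  rangeSum-indicator-below : ∀ {a} k → m < a → rangeSum (λ t → f t * 𝟙 (m ≟ t)) a k ≡ 0
  rangeSum-indicator-below zero    m<a = refl
  rangeSum-indicator-below {a} (suc k) m<a =
    cong₂ _+_ (trans (cong (f a *_) (𝟙-no (<⇒≢ m<a) (m ≟ a))) (*-zeroʳ (f a)))
              (rangeSum-indicator-below k (m<n⇒m<1+n m<a))

  rangeSum-indicator : ∀ {a} k → m ∈[ a ,+ k ⟩ → rangeSum (λ t → f t * 𝟙 (m ≟ t)) a k ≡ f m
  rangeSum-indicator zero    m∈ = contradiction m∈ ∉-empty
  rangeSum-indicator {a} (suc k) m∈ with ∈-split m∈
  ... | inj₁ refl = trans (cong₂ _+_ (trans (cong (f m *_) (𝟙-yes refl (m ≟ m))) (*-identityʳ (f m)))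
                                    (rangeSum-indicator-below k ≤-refl))
                          (+-identityʳ (f m))
  ... | inj₂ m∈′  = cong₂ _+_ (trans (cong (f a *_) (𝟙-no (<⇒≢ (proj₁ m∈′) ∘ sym) (m ≟ a))) (*-zeroʳ (f a)))
                              (rangeSum-indicator k m∈′)

tri : ℕ → ℕ
tri = rangeSum pred 1

rangeSum-pred-shift : ∀ s a k → rangeSum pred (suc (s + a)) k ≡ s * k + rangeSum pred (suc a) k
rangeSum-pred-shift s a zero    = sym (trans (+-identityʳ (s * 0)) (*-zeroʳ s))
rangeSum-pred-shift s a (suc k) = begin
  s + a + rangeSum pred (suc (suc (s + a))) k ≡⟨ cong (λ b → s + a + rangeSum pred (suc b) k) (sym (+-suc s a)) ⟩
  s + a + rangeSum pred (suc (s + suc a)) k   ≡⟨ cong (s + a +_) (rangeSum-pred-shift s (suc a) k) ⟩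
  s + a + (s * k + R)                         ≡⟨ lemma s a k R ⟩
  s * suc k + (a + R)                         ∎
  where
  open ≡-Reasoning
  R = rangeSum pred (suc (suc a)) k
  lemma : ∀ s a k R → s + a + (s * k + R) ≡ s * suc k + (a + R)
  lemma = solve-∀

rangeSum-pred-from : ∀ s k → rangeSum pred (suc s) k ≡ s * k + tri k
rangeSum-pred-from s k = trans (cong (λ b → rangeSum pred (suc b) k) (sym (+-identityʳ s)))
                               (rangeSum-pred-shift s 0 k)

tri-suc : ∀ q → tri (suc q) ≡ q + tri q
tri-suc q = trans (rangeSum-pred-from 1 q) (cong (_+ tri q) (*-identityˡ q))

tri-+ : ∀ a b → tri (a + b) ≡ tri a + (a * b + tri b)
tri-+ a b = trans (rangeSum-++ 1 a b) (cong (tri a +_) (rangeSum-pred-from a b))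

tri-double : ∀ q → 2 * tri q + q ≡ q * q
tri-double zero    = refl
tri-double (suc q) = begin
  2 * tri (suc q) + suc q   ≡⟨ cong (λ x → 2 * x + suc q) (tri-suc q) ⟩
  2 * (q + tri q) + suc q   ≡⟨ lemma q (tri q) ⟩
  (2 * tri q + q) + (2 * q + 1) ≡⟨ cong (_+ (2 * q + 1)) (tri-double q) ⟩
  q * q + (2 * q + 1)       ≡⟨ lemma′ q ⟩
  suc q * suc q             ∎
  where
  open ≡-Reasoning
  lemma : ∀ q T → 2 * (q + T) + suc q ≡ (2 * T + q) + (2 * q + 1)
  lemma = solve-∀
  lemma′ : ∀ q → q * q + (2 * q + 1) ≡ suc q * suc q
  lemma′ = solve-∀

tri-consecutive : ∀ q → tri (suc q) + tri q ≡ q * q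
tri-consecutive q = begin
  tri (suc q) + tri q ≡⟨ cong (_+ tri q) (tri-suc q) ⟩
  q + tri q + tri q   ≡⟨ lemma q (tri q) ⟩
  2 * tri q + q       ≡⟨ tri-double q ⟩
  q * q               ∎
  where
  open ≡-Reasoning
  lemma : ∀ q T → q + T + T ≡ 2 * T + q
  lemma = solve-∀

*≤tri-+ : ∀ a b → a * b ≤ tri (a + b)
*≤tri-+ a b = subst (a * b ≤_) (sym (tri-+ a b)) (≤-trans (m≤m+n (a * b) (tri b)) (m≤n+m _ (tri a)))

square-identity : ∀ s k → tri (s + (suc s + k)) + rangeSum pred (suc s) k ≡ (s + k) * (s + k) + s * (suc s + k)
square-identity s k = begin
  tri (s + r) + rangeSum pred (suc s) k                    ≡⟨ cong₂ _+_ (tri-+ s r) (rangeSum-pred-from s k) ⟩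
  tri s + (s * r + tri r) + (s * k + tri k)                ≡⟨ lemma (tri s) (s * r) (tri r) (s * k) (tri k) ⟩
  tri r + (tri s + (s * k + tri k)) + s * r                ≡⟨ cong (λ x → tri r + x + s * r) (sym (tri-+ s k)) ⟩
  tri (suc (s + k)) + tri (s + k) + s * r                  ≡⟨ cong (_+ s * r) (tri-consecutive (s + k)) ⟩
  (s + k) * (s + k) + s * r                                ∎
  where
  open ≡-Reasoning
  r = suc s + k
  lemma : ∀ A B C D E → A + (B + C) + (D + E) ≡ C + (A + (D + E)) + B
  lemma = solve-∀

module _ {f : ℕ → ℕ} where

  rangeSum-≤-extend : ∀ lo i k j → rangeSum f (lo + i) k ≤ rangeSum f lo (i + (k + j))
  rangeSum-≤-extend lo i k j = begin
    rangeSum f (lo + i) k                                          ≤⟨ m≤m+n _ _ ⟩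
    rangeSum f (lo + i) k + rangeSum f (lo + i + k) j              ≡⟨ sym (rangeSum-++ (lo + i) k j) ⟩
    rangeSum f (lo + i) (k + j)                                    ≤⟨ m≤n+m _ _ ⟩
    rangeSum f lo i + rangeSum f (lo + i) (k + j)                  ≡⟨ sym (rangeSum-++ lo i (k + j)) ⟩
    rangeSum f lo (i + (k + j))                                    ∎
    where open ≤-Reasoning

-- suffixSums g a k = ∑_{a ≤ i < a + k} ∑_{i < t < a + k} g t
suffixSums : (ℕ → ℕ) → ℕ → ℕ → ℕ
suffixSums g a zero    = 0
suffixSums g a (suc k) = rangeSum g (suc a) k + suffixSums g (suc a) k

suffixSums-≤ : ∀ {g c : ℕ → ℕ} a k → (∀ i j → a < i → i + j ≡ a + k → rangeSum g i j ≤ c i) →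
               suffixSums g a k ≤ rangeSum c (suc a) k
suffixSums-≤ a zero    suffix≤c = z≤n
suffixSums-≤ a (suc k) suffix≤c =
  +-mono-≤ (suffix≤c (suc a) k ≤-refl (sym (+-suc a k)))
           (suffixSums-≤ (suc a) k (λ i j a<i i+j≡ → suffix≤c i j (<⇒≤ a<i) (trans i+j≡ (sym (+-suc a k)))))

n≤1+pred[n] : ∀ n → n ≤ suc (pred n)
n≤1+pred[n] zero    = z≤n
n≤1+pred[n] (suc n) = ≤-refl

-- Level t holds 1 + f t vertices of weight pred t, or may be a singleton if g t = 1;
-- the loss on the singleton levels is charged to the suffix sums of g.
doubling-bound : ∀ {f g : ℕ → ℕ} a k → (∀ {t} → t ∈[ a ,+ k ⟩ → 1 ≤ f t + g t) →
  rangeSum pred a k ≤ rangeSum (λ t → pred t * f t) a k + suffixSums g a k + pred a * rangeSum g a k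
doubling-bound a zero    1≤f+g = z≤n
doubling-bound {f} {g} a (suc k) 1≤f+g = begin
  pred a + RP                                            ≤⟨ +-mono-≤ (m≤m*n (pred a) (f a + g a))
                                                                     (doubling-bound (suc a) k (1≤f+g ∘ ∈-later)) ⟩
  pred a * (f a + g a) + (RF + SS + a * RG)              ≤⟨ +-monoʳ-≤ (pred a * (f a + g a))
                                                              (+-monoʳ-≤ (RF + SS) (*-monoˡ-≤ RG (n≤1+pred[n] a))) ⟩
  pred a * (f a + g a) + (RF + SS + suc (pred a) * RG)   ≡⟨ lemma (pred a) (f a) (g a) RF SS RG ⟩
  (pred a * f a + RF) + (RG + SS) + pred a * (g a + RG)  ∎
  where
  open ≤-Reasoning
  RP = rangeSum pred (suc a) k
  RF = rangeSum (λ t → pred t * f t) (suc a) k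
  RG = rangeSum g (suc a) k
  SS = suffixSums g (suc a) k
  instance _ = >-nonZero (1≤f+g ∈-first)
  lemma : ∀ p x y F S G → p * (x + y) + (F + S + suc p * G) ≡ (p * x + F) + (G + S) + p * (y + G)
  lemma = solve-∀

-- In the graph, e is the level of the witness x_i and c i = d(u_i, v) − 1.
Covered : (N c : ℕ → ℕ) → ℕ → ℕ → Set
Covered N c r i = ∃[ e ] (r ≤ suc e + c i × (∀ t → i ≤ t → t ≤ e → 2 ≤ N t))

module LevelProfile (N c : ℕ → ℕ) (r M : ℕ)
  (occupied : ∀ {t} → t ∈[ 1 ,+ M ⟩ → 1 ≤ N t)
  (covered : ∀ i → M ∸ r < i → i ≤ M → Covered N c r i) where

  total : ℕ
  total = rangeSum (λ t → pred t * N t) 1 M + rangeSum c 1 M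

  private
    surplus single : ℕ → ℕ
    surplus t = N t ∸ 1
    single t  = 𝟙 (N t <? 2)

    surplus+single : ∀ t → 1 ≤ surplus t + single t
    surplus+single t with N t <? 2
    ... | yes _   = m≤n+m 1 (surplus t)
    ... | no  N≮2 = ≤-trans (∸-monoˡ-≤ 1 (≮⇒≥ N≮2)) (m≤m+n (surplus t) 0)

    single-doubled : ∀ {t} → 2 ≤ N t → single t ≡ 0
    single-doubled {t} 2≤N = 𝟙-no (≤⇒≯ 2≤N) (N t <? 2)

    weight-split : rangeSum (λ t → pred t * N t) 1 M ≡ tri M + rangeSum (λ t → pred t * surplus t) 1 M
    weight-split = trans (rangeSum-cong M weight-at) (rangeSum-distrib-+ 1 M)
      where
      weight-at : ∀ {t} → t ∈[ 1 ,+ M ⟩ → pred t * N t ≡ pred t + pred t * surplus t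
      weight-at {t} t∈ = begin
        pred t * N t               ≡⟨ cong (pred t *_) (sym (m+[n∸m]≡n (occupied t∈))) ⟩
        pred t * (1 + surplus t)   ≡⟨ *-distribˡ-+ (pred t) 1 (surplus t) ⟩
        pred t * 1 + pred t * surplus t ≡⟨ cong (_+ pred t * surplus t) (*-identityʳ (pred t)) ⟩
        pred t + pred t * surplus t ∎
        where open ≡-Reasoning

    single-suffix≤c : ∀ {s k} → r ≡ suc s + k → M ≡ s + r →
                      ∀ i j → suc s < i → i + j ≡ suc s + k → rangeSum single i j ≤ c i
    single-suffix≤c {s} r≡ M≡ i j s<i i+j≡ =
      let e , r≤ , doubled = covered i M∸r<i i≤M in begin
        rangeSum single i j     ≤⟨ rangeSum-vanishing (λ t → 𝟙≤1 (N t <? 2)) i j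
                                     (λ t i≤t t≤e → single-doubled (doubled t i≤t t≤e)) ⟩
        (i + j) ∸ suc e         ≡⟨ cong (_∸ suc e) (trans i+j≡ (sym r≡)) ⟩
        r ∸ suc e               ≤⟨ m≤n+o⇒m∸n≤o r (suc e) r≤ ⟩
        c i                     ∎
      where
      open ≤-Reasoning
      M∸r<i : M ∸ r < i
      M∸r<i = subst (_< i) (sym (trans (cong (_∸ r) M≡) (m+n∸n≡m s r))) (<⇒≤ s<i)
      i≤M : i ≤ M
      i≤M = ≤-trans (m≤m+n i j)
                    (subst (i + j ≤_) (sym M≡) (≤-trans (≤-reflexive (trans i+j≡ (sym r≡))) (m≤n+m r s)))

    total-lower-bound : ∀ s k → r ≡ suc s + k → M ≡ s + r →
           tri M + rangeSum pred (suc s) k + c (suc s) ≤ total + s * k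
    total-lower-bound s k r≡ M≡ = begin
      tri M + rangeSum pred (suc s) k + c (suc s)
        ≤⟨ +-monoˡ-≤ (c (suc s)) (+-monoʳ-≤ (tri M) (doubling-bound (suc s) k (λ {t} _ → surplus+single t))) ⟩
      tri M + (RF + suffixSums single (suc s) k + s * RG) + c (suc s)
        ≤⟨ +-monoˡ-≤ (c (suc s)) (+-monoʳ-≤ (tri M) (+-mono-≤ (+-mono-≤ RF≤ SS≤) (*-monoʳ-≤ s RG≤k))) ⟩
      tri M + (RFall + rangeSum c (suc (suc s)) k + s * k) + c (suc s)
        ≡⟨ lemma (tri M) RFall (rangeSum c (suc (suc s)) k) (s * k) (c (suc s)) ⟩
      tri M + RFall + rangeSum c (suc s) (suc k) + s * k
        ≤⟨ +-monoˡ-≤ (s * k) (+-monoʳ-≤ (tri M + RFall) c≤) ⟩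
      tri M + RFall + rangeSum c 1 M + s * k
        ≡⟨ cong (λ x → x + rangeSum c 1 M + s * k) (sym weight-split) ⟩
      total + s * k ∎
      where
      open ≤-Reasoning
      RF    = rangeSum (λ t → pred t * surplus t) (suc s) k
      RFall = rangeSum (λ t → pred t * surplus t) 1 M
      RG    = rangeSum single (suc s) k
      M≡₁ : M ≡ s + (k + suc s)
      M≡₁ = trans M≡ (cong (s +_) (trans r≡ (+-comm (suc s) k)))
      M≡₂ : M ≡ s + (suc k + s)
      M≡₂ = trans M≡ (cong (s +_) (trans r≡ (cong suc (+-comm s k))))
      RF≤ : RF ≤ RFall
      RF≤ = subst (λ m → RF ≤ rangeSum (λ t → pred t * surplus t) 1 m) (sym M≡₁) (rangeSum-≤-extend 1 s k (suc s))
      c≤ : rangeSum c (suc s) (suc k) ≤ rangeSum c 1 M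
      c≤ = subst (λ m → _ ≤ rangeSum c 1 m) (sym M≡₂) (rangeSum-≤-extend 1 s (suc k) s)
      SS≤ : suffixSums single (suc s) k ≤ rangeSum c (suc (suc s)) k
      SS≤ = suffixSums-≤ (suc s) k (single-suffix≤c r≡ M≡)
      RG≤k : RG ≤ k
      RG≤k = rangeSum-≤-length (λ t → 𝟙≤1 (N t <? 2)) (suc s) k
      lemma : ∀ T F C S x → T + (F + C + S) + x ≡ T + F + (x + C) + S
      lemma = solve-∀

  square+c₁≤total : 1 ≤ r → M ≡ r → (r ∸ 1) * (r ∸ 1) + c 1 ≤ total
  square+c₁≤total 1≤r M≡r = begin
    q * q + c 1                         ≡⟨ cong (_+ c 1) (sym (tri-consecutive q)) ⟩
    tri (suc q) + tri q + c 1           ≡⟨ cong (λ m → tri m + tri q + c 1) (sym (trans M≡r r≡)) ⟩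
    tri M + rangeSum pred 1 q + c 1     ≤⟨ total-lower-bound 0 q r≡ M≡r ⟩
    total + 0                           ≡⟨ +-identityʳ total ⟩
    total                               ∎
    where
    open ≤-Reasoning
    q = r ∸ 1
    r≡ : r ≡ suc q
    r≡ = sym (m+[n∸m]≡n 1≤r)

  square<total : 1 ≤ r → r < M → (r ∸ 1) * (r ∸ 1) < total
  square<total 1≤r r<M with M ∸ r <? r
  ... | yes s<r = +-cancelʳ-< (s * k) X total (begin-strict
    X + s * k                                ≡⟨ cong (λ q → q * q + s * k) (cong (_∸ 1) r≡) ⟩
    (s + k) * (s + k) + s * k                <⟨ +-monoʳ-< ((s + k) * (s + k)) (*-monoʳ-< s k<r) ⟩
    (s + k) * (s + k) + s * (suc s + k)      ≡⟨ sym (square-identity s k) ⟩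
    tri (s + (suc s + k)) + rangeSum pred (suc s) k ≡⟨ cong (λ m → tri m + rangeSum pred (suc s) k) (sym M≡′) ⟩
    tri M + rangeSum pred (suc s) k          ≤⟨ m≤m+n _ (c (suc s)) ⟩
    tri M + rangeSum pred (suc s) k + c (suc s) ≤⟨ total-lower-bound s k r≡ M≡ ⟩
    total + s * k                            ∎)
    where
    open ≤-Reasoning
    X = (r ∸ 1) * (r ∸ 1)
    s = M ∸ r
    instance _ = >-nonZero (m<n⇒0<n∸m r<M)
    k = r ∸ suc s
    r≡ : r ≡ suc s + k
    r≡ = sym (m+[n∸m]≡n s<r)
    M≡ : M ≡ s + r
    M≡ = sym (m∸n+n≡m (<⇒≤ r<M))
    M≡′ : M ≡ s + (suc s + k)
    M≡′ = trans M≡ (cong (s +_) r≡)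
    k<r : k < suc s + k
    k<r = s≤s (m≤n+m k s)
  ... | no s≮r = begin-strict
    (r ∸ 1) * (r ∸ 1)            <⟨ *-mono-< r∸1<r r∸1<r ⟩
    r * r                        ≤⟨ *-monoˡ-≤ r (≮⇒≥ s≮r) ⟩
    s * r                        ≤⟨ *≤tri-+ s r ⟩
    tri (s + r)                  ≡⟨ cong tri (sym M≡) ⟩
    tri M                        ≤⟨ m≤m+n (tri M) _ ⟩
    tri M + rangeSum (λ t → pred t * surplus t) 1 M ≡⟨ sym weight-split ⟩
    rangeSum (λ t → pred t * N t) 1 M ≤⟨ m≤m+n _ (rangeSum c 1 M) ⟩
    total                        ∎
    where
    open ≤-Reasoning
    s = M ∸ r
    M≡ : M ≡ s + r
    M≡ = sym (m∸n+n≡m (<⇒≤ r<M))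
    r∸1<r : r ∸ 1 < r
    r∸1<r = ∸-monoʳ-< z<s 1≤r

sum-mono : ∀ {m} {f g : Fin m → ℕ} → (∀ y → f y ≤ g y) → sum f ≤ sum g
sum-mono {zero}  f≤g = z≤n
sum-mono {suc m} f≤g = +-mono-≤ (f≤g Fin.zero) (sum-mono (λ y → f≤g (Fin.suc y)))

count : ∀ {n} {P : Fin n → Set} → Decidable P → ℕ
count P? = sum (λ y → 𝟙 (P? y))

count-≡ : ∀ {n} (x : Fin n) → count (_≟ᶠ x) ≡ 1
count-≡ {suc m} Fin.zero    = cong suc (sum-replicate-zero m)
count-≡ {suc m} (Fin.suc x) = trans (sum-cong-≗ (λ y → 𝟙-map′ (y ≟ᶠ x))) (count-≡ x)
  where
  𝟙-map′ : ∀ {a b} {A : Set a} {B : Set b} {f : A → B} {g : B → A} (A? : Dec A) → 𝟙 (map′ f g A?) ≡ 𝟙 A?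
  𝟙-map′ (yes _) = refl
  𝟙-map′ (no _)  = refl

private
  module Remove {n} {P : Fin n → Set} (P? : Decidable P) (x : Fin n) where

    P∖x? : Decidable (λ y → P y × y ≢ x)
    P∖x? y = P? y ×-dec ¬? (y ≟ᶠ x)

    𝟙-split-≤ : ∀ y → 𝟙 (P? y) ≤ 𝟙 (y ≟ᶠ x) + 𝟙 (P∖x? y)
    𝟙-split-≤ y with P? y | y ≟ᶠ x
    ... | no _  | _     = z≤n
    ... | yes _ | yes _ = s≤s z≤n
    ... | yes _ | no _  = s≤s z≤n

    𝟙-split-≥ : P x → ∀ y → 𝟙 (y ≟ᶠ x) + 𝟙 (P∖x? y) ≤ 𝟙 (P? y)
    𝟙-split-≥ Px y with P? y | y ≟ᶠ x
    ... | yes _ | yes _    = s≤s z≤n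
    ... | yes _ | no _     = s≤s z≤n
    ... | no ¬p | yes refl = contradiction Px ¬p
    ... | no _  | no _     = z≤n

    count-split : sum (λ y → 𝟙 (y ≟ᶠ x) + 𝟙 (P∖x? y)) ≡ suc (count P∖x?)
    count-split = trans (∑-distrib-+ (λ y → 𝟙 (y ≟ᶠ x)) (λ y → 𝟙 (P∖x? y))) (cong (_+ count P∖x?) (count-≡ x))

    count-≤-remove : count P? ≤ suc (count P∖x?)
    count-≤-remove = subst (count P? ≤_) count-split (sum-mono 𝟙-split-≤)

    count-≥-remove : P x → suc (count P∖x?) ≤ count P?
    count-≥-remove Px = subst (_≤ count P?) count-split (sum-mono (𝟙-split-≥ Px))

count-≥ : ∀ {n} {P : Fin n → Set} (P? : Decidable P) {xs} → Unique xs → All P xs → length xs ≤ count P?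
count-≥ P? []             []         = z≤n
count-≥ P? (x≢xs ∷ uniq) (Px ∷ Pxs) =
  ≤-trans (s≤s (count-≥ P∖x? uniq (All.map (λ (Py , x≢y) → Py , x≢y ∘ sym) (All.zip (Pxs , x≢xs)))))
          (count-≥-remove Px)
  where open Remove P? _

count-≤ : ∀ {n} {P : Fin n → Set} (P? : Decidable P) xs → (∀ {y} → P y → y ∈ xs) → count P? ≤ length xs
count-≤ {n} P? []       P⊆xs = ≤-reflexive (trans (sum-cong-≗ 𝟙≡0) (sum-replicate-zero n))
  where
  𝟙≡0 : ∀ y → 𝟙 (P? y) ≡ 0
  𝟙≡0 y = 𝟙-no (λ Py → case P⊆xs Py of λ ()) (P? y)
count-≤ {P = P} P? (x ∷ xs) P⊆xs = ≤-trans count-≤-remove (s≤s (count-≤ P∖x? xs P∖x⊆xs))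
  where
  open Remove P? x
  P∖x⊆xs : ∀ {y} → P y × y ≢ x → y ∈ xs
  P∖x⊆xs (Py , y≢x) with P⊆xs Py
  ... | here y≡x  = contradiction y≡x y≢x
  ... | there y∈ = y∈

sum-rangeSum : ∀ {n} (F : Fin n → ℕ → ℕ) a k →
               sum (λ y → rangeSum (F y) a k) ≡ rangeSum (λ t → sum (λ y → F y t)) a k
sum-rangeSum {n} F a zero    = sum-replicate-zero n
sum-rangeSum     F a (suc k) = trans (∑-distrib-+ (λ y → F y a) (λ y → rangeSum (F y) (suc a) k))
                                     (cong (sum (λ y → F y a) +_) (sum-rangeSum F (suc a) k))

sumFin-cong : ∀ {n} {f g : Fin n → ℕ∞} → (∀ y → f y ≡ g y) → sumFin f ≡ sumFin g
sumFin-cong {zero}  f≡g = refl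
sumFin-cong {suc n} f≡g = cong₂ _+∞_ (f≡g Fin.zero) (sumFin-cong (λ y → f≡g (Fin.suc y)))

sumFin-fin : ∀ {n} (f : Fin n → ℕ) → sumFin (λ y → fin (f y)) ≡ fin (sum f)
sumFin-fin {zero}  f = refl
sumFin-fin {suc n} f = cong (fin (f Fin.zero) +∞_) (sumFin-fin (λ y → f (Fin.suc y)))

-- The value 0 at ∞ is junk; it is only used where finiteness is known.
finitePart : ℕ∞ → ℕ
finitePart (fin k) = k
finitePart ∞       = 0

<∞-fin : ∀ {z₁ z₂ z₃ a b c} → z₁ ≡ fin a → z₂ ≡ fin b → z₃ ≡ fin c → z₁ <∞ (z₂ +∞ z₃) → a < b + c
<∞-fin refl refl refl (fin<fin a<b+c) = a<b+c

≤∞-fin : ∀ {a z₂ z₃ b c} → z₂ ≡ fin b → z₃ ≡ fin c → fin a ≤∞ (z₂ +∞ z₃) → a ≤ b + c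
≤∞-fin refl refl (fin≤fin a≤b+c) = a≤b+c

fin-injective : ∀ {a b} → fin a ≡ fin b → a ≡ b
fin-injective refl = refl

x+∞∞≡∞ : ∀ x → x +∞ ∞ ≡ ∞
x+∞∞≡∞ (fin _) = refl
x+∞∞≡∞ ∞       = refl

finite-or-∞ : ∀ (f : ℕ → ℕ∞) a k →
              (∀ {i} → i ∈[ a ,+ k ⟩ → f i ≡ fin (finitePart (f i))) ⊎ ∃[ i ] (i ∈[ a ,+ k ⟩ × f i ≡ ∞)
finite-or-∞ f a zero    = inj₁ (λ i∈ → contradiction i∈ ∉-empty)
finite-or-∞ f a (suc k) with f a in fa≡ | finite-or-∞ f (suc a) k
... | ∞     | _                    = inj₂ (a , ∈-first , fa≡)
... | fin _ | inj₂ (i , i∈ , fi≡∞) = inj₂ (i , ∈-later i∈ , fi≡∞)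
... | fin _ | inj₁ finite          = inj₁ finite′
  where
  finite′ : ∀ {i} → i ∈[ a ,+ suc k ⟩ → f i ≡ fin (finitePart (f i))
  finite′ i∈ with ∈-split i∈
  ... | inj₁ refl = trans fa≡ (cong (fin ∘ finitePart) (sym fa≡))
  ... | inj₂ i∈′  = finite i∈′

sum1to-fin : ∀ {f : ℕ → ℕ∞} {g : ℕ → ℕ} m → (∀ {i} → i ∈[ 1 ,+ m ⟩ → f i ≡ fin (g i)) →
             sum1to m f ≡ fin (rangeSum g 1 m)
sum1to-fin zero    f≡g = refl
sum1to-fin {g = g} (suc m) f≡g = trans (cong₂ _+∞_ (sum1to-fin m (f≡g ∘ ∈-init)) (f≡g ∈-last))
                                       (cong fin (sym (rangeSum-snoc 1 m)))

sum1to-∞ : ∀ {f : ℕ → ℕ∞} {i} m → i ∈[ 1 ,+ m ⟩ → f i ≡ ∞ → sum1to m f ≡ ∞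
sum1to-∞ zero    i∈ fi≡∞ = contradiction i∈ ∉-empty
sum1to-∞ {f} (suc m) i∈ fi≡∞ with ∈-split-last i∈
... | inj₁ i∈′  = cong (_+∞ f (suc m)) (sum1to-∞ m i∈′ fi≡∞)
... | inj₂ refl = trans (cong (sum1to m f +∞_) fi≡∞) (x+∞∞≡∞ _)

module Distances (D : Digraph) (d : V D → V D → ℕ∞) (isDist : IsDistanceFunction D d) where

  _++ʷ_ : ∀ {x y z j k} → Walk D x y j → Walk D y z k → Walk D x z (j + k)
  here     ++ʷ q = q
  step a p ++ʷ q = step a (p ++ʷ q)

  dist-≤-walk : ∀ {x y k m} → d x y ≡ fin k → Walk D x y m → k ≤ m
  dist-≤-walk {x} {y} eq w with d x y | isDist x y | eq
  ... | fin _ | _ , minimal | refl = minimal _ w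

  walk-of-dist : ∀ {x y k} → d x y ≡ fin k → Walk D x y k
  walk-of-dist {x} {y} eq with d x y | isDist x y | eq
  ... | fin _ | w , _ | refl = w

  walk⇒dist-finite : ∀ {x y m} → Walk D x y m → ∃[ k ] d x y ≡ fin k
  walk⇒dist-finite {x} {y} w with d x y | isDist x y
  ... | fin k | _         = k , refl
  ... | ∞     | no-walk   = contradiction w (no-walk _)

  dist≡0⇒≡ : ∀ {x y} → d x y ≡ fin 0 → x ≡ y
  dist≡0⇒≡ eq with walk-of-dist eq
  ... | here = refl

  dist-refl : ∀ x → d x x ≡ fin 0
  dist-refl x with walk⇒dist-finite {x} here
  ... | k , eq with dist-≤-walk eq here
  ...   | z≤n = eq

  Arcs : (ℕ → V D) → ℕ → Set
  Arcs p L = ∀ i → i < L → Arc D (p i) (p (suc i))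

  module _ {p : ℕ → V D} {L : ℕ} (arcs : Arcs p L) where

    private
      segment : ∀ i k → i + k ≤ L → Walk D (p i) (p (i + k)) k
      segment i zero    _ = subst (λ z → Walk D (p i) z 0) (cong p (sym (+-identityʳ i))) here
      segment i (suc k) i+k<L =
        step (arcs i (≤-trans (s≤s (m≤m+n i k)) (subst (_≤ L) (+-suc i k) i+k<L)))
             (subst (λ z → Walk D (p (suc i)) z k) (cong p (sym (+-suc i k)))
                    (segment (suc i) k (subst (_≤ L) (+-suc i k) i+k<L)))

    subpath : ∀ {i j} → i ≤ j → j ≤ L → Walk D (p i) (p j) (j ∸ i)
    subpath {i} i≤j j≤L = subst (λ z → Walk D (p i) z _) (cong p (m+[n∸m]≡n i≤j))
                                (segment i _ (subst (_≤ L) (sym (m+[n∸m]≡n i≤j)) j≤L))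

    prefix-dist : ∀ {x} → p 0 ≡ x → d x (p L) ≡ fin L → ∀ i → i ≤ L → d x (p i) ≡ fin i
    prefix-dist refl dL i i≤L with walk⇒dist-finite (subpath z≤n i≤L)
    ... | k , dk = subst (λ m → d (p 0) (p i) ≡ fin m) (≤-antisym k≤i i≤k) dk
      where
      k≤i : k ≤ i
      k≤i = dist-≤-walk dk (subpath z≤n i≤L)
      i≤k : i ≤ k
      i≤k = +-cancelʳ-≤ (L ∸ i) i k (subst (_≤ k + (L ∸ i)) (sym (m+[n∸m]≡n i≤L))
                          (dist-≤-walk dL (walk-of-dist dk ++ʷ subpath i≤L ≤-refl)))

  vertexAt : ∀ {x y k} → Walk D x y k → ℕ → V D
  vertexAt {x} here       _       = x
  vertexAt {x} (step _ w) zero    = x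
  vertexAt     (step _ w) (suc j) = vertexAt w j

  vertexAt-start : ∀ {x y k} (w : Walk D x y k) → vertexAt w 0 ≡ x
  vertexAt-start here       = refl
  vertexAt-start (step _ w) = refl

  vertexAt-end : ∀ {x y k} (w : Walk D x y k) → vertexAt w k ≡ y
  vertexAt-end here       = refl
  vertexAt-end (step _ w) = vertexAt-end w

  vertexAt-arcs : ∀ {x y k} (w : Walk D x y k) → Arcs (vertexAt w) k
  vertexAt-arcs (step a w) zero    _         = subst (Arc D _) (sym (vertexAt-start w)) a
  vertexAt-arcs (step a w) (suc i) (s≤s i<k) = vertexAt-arcs w i i<k

module Levels (D : Digraph) (d : V D → V D → ℕ∞) (isDist : IsDistanceFunction D d)
  (v : V D) (M : ℕ) (ecc : OutEccentricity D d v M) where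

  open Distances D d isDist

  private
    bounded-finite : ∀ {z} → z ≤∞ fin M → ∃[ k ] (z ≡ fin k × k ≤ M)
    bounded-finite (fin≤fin k≤M) = _ , refl , k≤M

  level : V D → ℕ
  level y = proj₁ (bounded-finite (proj₁ ecc y))

  d≡level : ∀ y → d v y ≡ fin (level y)
  d≡level y = proj₁ (proj₂ (bounded-finite (proj₁ ecc y)))

  level≤M : ∀ y → level y ≤ M
  level≤M y = proj₂ (proj₂ (bounded-finite (proj₁ ecc y)))

  level-unique : ∀ {y k} → d v y ≡ fin k → level y ≡ k
  level-unique {y} eq = fin-injective (trans (sym (d≡level y)) eq)

  level-v : level v ≡ 0
  level-v = level-unique (dist-refl v)

  level≡0⇒≡v : ∀ {y} → level y ≡ 0 → y ≡ v
  level≡0⇒≡v {y} eq = sym (dist≡0⇒≡ (trans (d≡level y) (cong fin eq)))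

  path-level : ∀ {p : ℕ → V D} {L} → p 0 ≡ v → Arcs p L → d v (p L) ≡ fin L →
               ∀ i → i ≤ L → level (p i) ≡ i
  path-level p0≡v arcs dL i i≤L = level-unique (prefix-dist arcs p0≡v dL i i≤L)

  geodesic : V D → ℕ → V D
  geodesic x = vertexAt (walk-of-dist (d≡level x))

  geodesic-start : ∀ x → geodesic x 0 ≡ v
  geodesic-start x = vertexAt-start (walk-of-dist (d≡level x))

  geodesic-end : ∀ x → geodesic x (level x) ≡ x
  geodesic-end x = vertexAt-end (walk-of-dist (d≡level x))

  geodesic-arcs : ∀ x → Arcs (geodesic x) (level x)
  geodesic-arcs x = vertexAt-arcs (walk-of-dist (d≡level x))

  geodesic-level : ∀ x t → t ≤ level x → level (geodesic x t) ≡ t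
  geodesic-level x = path-level (geodesic-start x) (geodesic-arcs x)
                        (trans (cong (d v) (geodesic-end x)) (d≡level x))

  levelCount : ℕ → ℕ
  levelCount t = count (λ y → level y ≟ t)

  outWeight : ℕ
  outWeight = rangeSum (λ t → pred t * levelCount t) 1 M

  sum-pred-level : sum (pred ∘ level) ≡ outWeight
  sum-pred-level = begin
    sum (pred ∘ level)                            ≡⟨ sum-cong-≗ (λ y → sym (by-level y)) ⟩
    sum (λ y → rangeSum (F y) 0 (suc M))          ≡⟨ sum-rangeSum F 0 (suc M) ⟩
    rangeSum (λ t → sum (λ y → F y t)) 0 (suc M)  ≡⟨ rangeSum-cong (suc M) (λ {t} _ → factor t) ⟩
    rangeSum (λ t → pred t * levelCount t) 0 (suc M) ≡⟨⟩
    outWeight                                     ∎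
    where
    open ≡-Reasoning
    indicator : ℕ → V D → ℕ
    indicator t y = 𝟙 (level y ≟ t)
    F : V D → ℕ → ℕ
    F y t = pred t * indicator t y
    factor : ∀ t → sum (λ y → F y t) ≡ pred t * levelCount t
    factor t = sym (*-distribˡ-sum (pred t) (indicator t))
    by-level : ∀ y → rangeSum (F y) 0 (suc M) ≡ pred (level y)
    by-level y = rangeSum-indicator pred (level y) (suc M) (z≤n , s≤s (level≤M y))

  sumOut≡ : sumOut D d v ≡ fin outWeight
  sumOut≡ = trans (sumFin-cong term≡) (trans (sumFin-fin (pred ∘ level)) (cong fin sum-pred-level))
    where
    term≡ : ∀ y → (if ⌊ y ≟ᶠ v ⌋ then fin 0 else pred∞ (d v y)) ≡ fin (pred (level y))
    term≡ y with y ≟ᶠ v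
    ... | yes refl = cong (fin ∘ pred) (sym level-v)
    ... | no _     = cong pred∞ (d≡level y)

module Configuration (D : Digraph) (d : V D → V D → ℕ∞) (isDist : IsDistanceFunction D d)
  (v : V D) (r M : ℕ) (3≤r : 3 ≤ r) (r≤M : r ≤ M) (ecc : OutEccentricity D d v M)
  (u : ℕ → V D) (u0 : u 0 ≡ v) (upath : IsDirPath D u M) (du : d v (u M) ≡ fin M)
  (witness : ∀ i → M ∸ r + 1 ≤ i → i ≤ M →
    ∃ (λ x → (d v x <∞ (d v (u i) +∞ d (u i) x)) × (fin r ≤∞ (d (u i) v +∞ d v x)))) where

  open Distances D d isDist
  open Levels D d isDist v M ecc
  open DecMembership (_≟ᶠ_ {n D}) using (_∈?_)

  1≤r : 1 ≤ r
  1≤r = ≤-trans (s≤s z≤n) 3≤r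

  u-level : ∀ i → i ≤ M → level (u i) ≡ i
  u-level = path-level u0 (proj₁ upath) du

  u-d≡ : ∀ {i} → i ≤ M → d v (u i) ≡ fin i
  u-d≡ {i} i≤M = trans (d≡level (u i)) (cong fin (u-level i i≤M))

  occupied : ∀ {t} → t ∈[ 1 ,+ M ⟩ → 1 ≤ levelCount t
  occupied {t} (_ , s≤s t≤M) = count-≥ (λ y → level y ≟ t) ([] ∷ []) (u-level t t≤M ∷ [])

  module Witness (i : ℕ) (i-range : M ∸ r + 1 ≤ i) (i≤M : i ≤ M) where

    x : V D
    x = proj₁ (witness i i-range i≤M)

    off-route : d v x <∞ (d v (u i) +∞ d (u i) x)
    off-route = proj₁ (proj₂ (witness i i-range i≤M))

    far : fin r ≤∞ (d (u i) v +∞ d v x)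
    far = proj₂ (proj₂ (witness i i-range i≤M))

    detour : ∀ {t} → i ≤ t → t ≤ level x → geodesic x t ≡ u t → Walk D (u i) x ((t ∸ i) + (level x ∸ t))
    detour {t} i≤t t≤e γt≡ut =
      subpath (proj₁ upath) i≤t (≤-trans t≤e (level≤M x))
      ++ʷ subst₂ (λ y z → Walk D y z (level x ∸ t)) γt≡ut (geodesic-end x)
                 (subpath (geodesic-arcs x) t≤e ≤-refl)

    -- Meeting u at level t ≥ i would give the walk u i ⇝ u t ⇝ x of length d(v, x) − i,
    -- against d(v, x) < d(v, u i) + d(u i, x).
    geodesic≢u : ∀ t → i ≤ t → t ≤ level x → geodesic x t ≢ u t
    geodesic≢u t i≤t t≤e γt≡ut with walk⇒dist-finite (detour i≤t t≤e γt≡ut)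
    ... | m , dm = <-irrefl refl (begin-strict
      level x                                 <⟨ <∞-fin (d≡level x) (u-d≡ i≤M) dm off-route ⟩
      i + m                                   ≤⟨ +-monoʳ-≤ i (dist-≤-walk dm (detour i≤t t≤e γt≡ut)) ⟩
      i + ((t ∸ i) + (level x ∸ t))           ≡⟨ sym (+-assoc i (t ∸ i) _) ⟩
      i + (t ∸ i) + (level x ∸ t)             ≡⟨ cong (_+ (level x ∸ t)) (m+[n∸m]≡n i≤t) ⟩
      t + (level x ∸ t)                       ≡⟨ m+[n∸m]≡n t≤e ⟩
      level x                                 ∎)
      where open ≤-Reasoning

    doubled : ∀ t → i ≤ t → t ≤ level x → 2 ≤ levelCount t
    doubled t i≤t t≤e = count-≥ (λ y → level y ≟ t) ((geodesic≢u t i≤t t≤e ∷ []) ∷ [] ∷ [])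
                                 (geodesic-level x t t≤e ∷ u-level t (≤-trans t≤e (level≤M x)) ∷ [])

    return-bound : ∀ {b} → d (u i) v ≡ fin b → r ≤ b + level x
    return-bound eq = ≤∞-fin eq (d≡level x) far

  Extremal : Set
  Extremal =
    (M ≡ r) ×
    ∃ (λ (w : ℕ → V D) →
      (w 0 ≡ v) × IsDirPath D w (r ∸ 1) × (d v (w (r ∸ 1)) ≡ fin (r ∸ 1)) ×
      (∀ i j → i ≤ r → j ≤ r ∸ 1 → w j ≡ u i → w j ≡ v) ×
      (∀ i → 1 ≤ i → i ≤ r → d (u i) v ≡ fin 1) ×
      (∀ y → (∀ i → i ≤ r → ¬ y ≡ u i) → (∀ j → j ≤ r ∸ 1 → ¬ y ≡ w j) →
        d v y ≡ fin 1))

  module TwoPaths (M≡r : M ≡ r) (w : ℕ → V D) (w-level : ∀ j → j ≤ r ∸ 1 → level (w j) ≡ j)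
                  (u≢w : ∀ t → 1 ≤ t → t ≤ r ∸ 1 → u t ≢ w t) where

    expected : ℕ → List (V D)
    expected t with t ≤? r ∸ 1
    ... | yes _ = u t ∷ w t ∷ []
    ... | no _  = u t ∷ []

    expected-level : ∀ {t} → t ≤ M → All (λ y → level y ≡ t) (expected t)
    expected-level {t} t≤M with t ≤? r ∸ 1
    ... | yes t≤ = u-level t t≤M ∷ w-level t t≤ ∷ []
    ... | no _   = u-level t t≤M ∷ []

    expected-unique : ∀ {t} → 1 ≤ t → Unique (expected t)
    expected-unique {t} 1≤t with t ≤? r ∸ 1
    ... | yes t≤ = (u≢w t 1≤t t≤ ∷ []) ∷ [] ∷ []
    ... | no _   = [] ∷ []

    expected-weight : rangeSum (λ t → pred t * length (expected t)) 1 M ≡ (r ∸ 1) * (r ∸ 1)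
    expected-weight = begin
      rangeSum g 1 M                        ≡⟨ cong (rangeSum g 1) (trans M≡r r≡) ⟩
      rangeSum g 1 (suc q)                  ≡⟨ rangeSum-snoc 1 q ⟩
      rangeSum g 1 q + g (suc q)            ≡⟨ cong₂ _+_ (rangeSum-cong q twice) last ⟩
      rangeSum (λ t → pred t + pred t) 1 q + q ≡⟨ cong (_+ q) (rangeSum-distrib-+ 1 q) ⟩
      tri q + tri q + q                     ≡⟨ cong (λ T → T + q) (cong (tri q +_) (sym (+-identityʳ (tri q)))) ⟩
      2 * tri q + q                         ≡⟨ tri-double q ⟩
      q * q                                 ∎
      where
      open ≡-Reasoning
      g = λ t → pred t * length (expected t)
      q = r ∸ 1
      r≡ : r ≡ suc q
      r≡ = sym (m+[n∸m]≡n 1≤r)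
      twice : ∀ {t} → t ∈[ 1 ,+ q ⟩ → g t ≡ pred t + pred t
      twice {t} (_ , s≤s t≤q) with t ≤? r ∸ 1
      ... | yes _   = trans (*-comm (pred t) 2) (cong (pred t +_) (+-identityʳ (pred t)))
      ... | no t≰q  = contradiction t≤q t≰q
      last : g (suc q) ≡ q
      last with suc q ≤? r ∸ 1
      ... | yes q<q = contradiction q<q (<-irrefl refl)
      ... | no _    = *-identityʳ q

    ∉-expected : ∀ {y t} → y ≢ u t → (t ≤ r ∸ 1 → y ≢ w t) → y ∉ expected t
    ∉-expected {y} {t} y≢ut y≢wt with t ≤? r ∸ 1
    ... | yes t≤ = λ { (here y≡ut) → y≢ut y≡ut ; (there (here y≡wt)) → y≢wt t≤ y≡wt }
    ... | no _   = λ { (here y≡ut) → y≢ut y≡ut }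

    u∈expected : ∀ t → u t ∈ expected t
    u∈expected t with t ≤? r ∸ 1
    ... | yes _ = here refl
    ... | no _  = here refl

    w∈expected : ∀ {j} → j ≤ r ∸ 1 → w j ∈ expected j
    w∈expected {j} j≤ with j ≤? r ∸ 1
    ... | yes _  = there (here refl)
    ... | no j≰  = contradiction j≤ j≰

    off-paths : ∀ {y} → y ∉ expected (level y) →
                (∀ i → i ≤ r → y ≢ u i) × (∀ j → j ≤ r ∸ 1 → y ≢ w j)
    off-paths {y} y∉ = y≢u , y≢w
      where
      y≢u : ∀ i → i ≤ r → y ≢ u i
      y≢u i i≤r y≡ui = y∉ (subst (λ z → z ∈ expected (level z)) (sym y≡ui)
                         (subst (λ t → u i ∈ expected t) (sym (u-level i (subst (i ≤_) (sym M≡r) i≤r))) (u∈expected i)))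
      y≢w : ∀ j → j ≤ r ∸ 1 → y ≢ w j
      y≢w j j≤ y≡wj = y∉ (subst (λ z → z ∈ expected (level z)) (sym y≡wj)
                         (subst (λ t → w j ∈ expected t) (sym (w-level j j≤)) (w∈expected j≤)))

    expected≤count : ∀ {t} → t ∈[ 1 ,+ M ⟩ → pred t * length (expected t) ≤ pred t * levelCount t
    expected≤count {t} (1≤t , s≤s t≤M) =
      *-monoʳ-≤ (pred t) (count-≥ (λ y → level y ≟ t) (expected-unique 1≤t) (expected-level t≤M))

    square≤outWeight : (r ∸ 1) * (r ∸ 1) ≤ outWeight
    square≤outWeight = subst (_≤ outWeight) expected-weight (rangeSum-mono M expected≤count)

    square<outWeight : ∀ {y} → 2 ≤ level y → y ∉ expected (level y) → (r ∸ 1) * (r ∸ 1) < outWeight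
    square<outWeight {y} 2≤t y∉ =
      subst (_< outWeight) expected-weight (rangeSum-< M expected≤count (1≤t , s≤s (level≤M y)) more)
      where
      t = level y
      1≤t : 1 ≤ t
      1≤t = ≤-trans (s≤s z≤n) 2≤t
      instance _ = >-nonZero (∸-monoˡ-≤ 1 2≤t)
      more : pred t * length (expected t) < pred t * levelCount t
      more = *-monoʳ-< (pred t) (count-≥ (λ z → level z ≟ t) (¬Any⇒All¬ _ y∉ ∷ expected-unique 1≤t)
                                           (refl ∷ expected-level (level≤M y)))

    outWeight≡square : (∀ {y} → 2 ≤ level y → y ∈ expected (level y)) → outWeight ≡ (r ∸ 1) * (r ∸ 1)
    outWeight≡square all-expected = trans (rangeSum-cong M exact) expected-weight
      where
      exact : ∀ {t} → t ∈[ 1 ,+ M ⟩ → pred t * levelCount t ≡ pred t * length (expected t)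
      exact {suc zero}    _                 = refl
      exact {t@(suc (suc _))} (1≤t , s≤s t≤M) = cong (pred t *_) (≤-antisym
        (count-≤ (λ y → level y ≟ t) (expected t) (λ {y} y-at-t → subst (λ s → y ∈ expected s) y-at-t
                                                       (all-expected (≤-trans (s≤s (s≤s z≤n)) (≤-reflexive (sym y-at-t))))))
        (count-≥ (λ y → level y ≟ t) (expected-unique 1≤t) (expected-level t≤M)))

  module Returning (returns : ∀ {i} → i ∈[ 1 ,+ M ⟩ → d (u i) v ≡ fin (finitePart (d (u i) v))) where

    c : ℕ → ℕ
    c i = pred (finitePart (d (u i) v))

    d-back≡ : ∀ {i} → i ∈[ 1 ,+ M ⟩ → d (u i) v ≡ fin (suc (c i))
    d-back≡ {i} i∈@(1≤i , s≤s i≤M) = trans (returns i∈) (cong fin (sym (suc-pred _ {{≢-nonZero back≢0}})))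
      where
      back≢0 : finitePart (d (u i) v) ≢ 0
      back≢0 b≡0 = <⇒≢ 1≤i (trans (sym (u-level 0 z≤n)) (trans (cong level (trans u0 ui≡v)) (u-level i i≤M)))
        where
        ui≡v : v ≡ u i
        ui≡v = sym (dist≡0⇒≡ (trans (returns i∈) (cong fin b≡0)))

    covered : ∀ i → M ∸ r < i → i ≤ M → Covered levelCount c r i
    covered i M∸r<i i≤M = level x , r≤ , doubled
      where
      open Witness i (subst (_≤ i) (+-comm 1 (M ∸ r)) M∸r<i) i≤M
      r≤ : r ≤ suc (level x) + c i
      r≤ = subst (r ≤_) (cong suc (+-comm (c i) (level x)))
                 (return-bound (d-back≡ (≤-trans (s≤s z≤n) M∸r<i , s≤s i≤M)))

    open LevelProfile levelCount c r M occupied covered public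

    total≡ : sumOut D d v +∞ sum1to M (λ i → pred∞ (d (u i) v)) ≡ fin total
    total≡ = cong₂ _+∞_ sumOut≡ (sum1to-fin M (cong pred∞ ∘ d-back≡))

    square≤total : (r ∸ 1) * (r ∸ 1) ≤ total
    square≤total with m≤n⇒m<n∨m≡n r≤M
    ... | inj₁ r<M = <⇒≤ (square<total 1≤r r<M)
    ... | inj₂ r≡M = ≤-trans (m≤m+n _ (c 1)) (square+c₁≤total 1≤r (sym r≡M))

    -- In an extremal configuration, the shortest path to the witness x of u 1 is the second path.
    module SecondPath (M≡r : M ≡ r) (c₁≡0 : c 1 ≡ 0) where

      open Witness 1 (subst (λ s → s + 1 ≤ 1) (sym (trans (cong (_∸ r) M≡r) (n∸n≡0 r))) ≤-refl) (≤-trans 1≤r r≤M)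
        public

      w : ℕ → V D
      w = geodesic x

      r∸1≤e : r ∸ 1 ≤ level x
      r∸1≤e = m≤n+o⇒m∸n≤o r 1 (subst (λ b → r ≤ b + level x) (cong suc c₁≡0)
                                       (return-bound (d-back≡ (≤-refl , s≤s (≤-trans 1≤r r≤M)))))

      w-level : ∀ j → j ≤ r ∸ 1 → level (w j) ≡ j
      w-level j j≤ = geodesic-level x j (≤-trans j≤ r∸1≤e)

      w-path : IsDirPath D w (r ∸ 1)
      w-path = (λ j j< → geodesic-arcs x j (≤-trans j< r∸1≤e))
             , (λ i j i≤ j≤ wi≡wj → trans (sym (w-level i i≤)) (trans (cong level wi≡wj) (w-level j j≤)))

      w-end : d v (w (r ∸ 1)) ≡ fin (r ∸ 1)
      w-end = trans (d≡level _) (cong fin (w-level (r ∸ 1) ≤-refl))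

      u≢w : ∀ t → 1 ≤ t → t ≤ r ∸ 1 → u t ≢ w t
      u≢w t 1≤t t≤ = geodesic≢u t 1≤t (≤-trans t≤ r∸1≤e) ∘ sym

      meets-u⇒≡v : ∀ i j → i ≤ r → j ≤ r ∸ 1 → w j ≡ u i → w j ≡ v
      meets-u⇒≡v i zero    _   _  _     = geodesic-start x
      meets-u⇒≡v i (suc j) i≤r j≤ wj≡ui =
        contradiction (trans wj≡ui (cong u (sym j≡i))) (u≢w (suc j) (s≤s z≤n) j≤ ∘ sym)
        where
        j≡i : suc j ≡ i
        j≡i = trans (sym (w-level (suc j) j≤)) (trans (cong level wj≡ui) (u-level i (≤-trans i≤r r≤M)))

      open TwoPaths M≡r w w-level u≢w public

    total-extremal : total ≡ (r ∸ 1) * (r ∸ 1) → Extremal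
    total-extremal total≡X = M≡r , w , geodesic-start x , w-path , w-end , meets-u⇒≡v , back≡1 , others
      where
      X = (r ∸ 1) * (r ∸ 1)

      M≡r : M ≡ r
      M≡r with m≤n⇒m<n∨m≡n r≤M
      ... | inj₁ r<M = contradiction total≡X (>⇒≢ (square<total 1≤r r<M))
      ... | inj₂ r≡M = sym r≡M

      c₁≡0 : c 1 ≡ 0
      c₁≡0 = n≤0⇒n≡0 (+-cancelˡ-≤ X (c 1) 0 (subst (X + c 1 ≤_) (trans total≡X (sym (+-identityʳ X)))
                                                      (square+c₁≤total 1≤r M≡r)))

      open SecondPath M≡r c₁≡0

      back≡1 : ∀ i → 1 ≤ i → i ≤ r → d (u i) v ≡ fin 1
      back≡1 i 1≤i i≤r =
        trans (d-back≡ i∈) (cong (fin ∘ suc) (n≤0⇒n≡0 (≤-trans (rangeSum-term M i∈) returns-sum≤0)))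
        where
        i∈ : i ∈[ 1 ,+ M ⟩
        i∈ = 1≤i , s≤s (≤-trans i≤r r≤M)
        returns-sum≤0 : rangeSum c 1 M ≤ 0
        returns-sum≤0 = +-cancelˡ-≤ X _ 0 (subst (X + rangeSum c 1 M ≤_) (trans total≡X (sym (+-identityʳ X)))
                                                  (+-monoˡ-≤ _ square≤outWeight))

      others : ∀ y → (∀ i → i ≤ r → ¬ y ≡ u i) → (∀ j → j ≤ r ∸ 1 → ¬ y ≡ w j) → d v y ≡ fin 1
      others y y≢u y≢w with level y in level≡
      ... | zero        = contradiction (trans (level≡0⇒≡v level≡) (sym u0)) (y≢u 0 z≤n)
      ... | suc zero    = trans (d≡level y) (cong fin level≡)
      ... | suc (suc _) = contradiction total≡X (>⇒≢ (<-≤-trans (square<outWeight 2≤level y∉) (m≤m+n _ _)))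
        where
        2≤level : 2 ≤ level y
        2≤level = subst (2 ≤_) (sym level≡) (s≤s (s≤s z≤n))
        y∉ : y ∉ expected (level y)
        y∉ = ∉-expected (y≢u (level y) (subst (level y ≤_) M≡r (level≤M y))) (y≢w (level y))

    extremal-total : Extremal → total ≡ (r ∸ 1) * (r ∸ 1)
    extremal-total (M≡r , w , w0 , (w-arcs , _) , w-end , meets-u⇒≡v , back≡1 , others) = begin
      total                                  ≡⟨ cong₂ _+_ (outWeight≡square all-expected) returns-sum≡0 ⟩
      (r ∸ 1) * (r ∸ 1) + 0                  ≡⟨ +-identityʳ _ ⟩
      (r ∸ 1) * (r ∸ 1)                      ∎
      where
      open ≡-Reasoning

      w-level : ∀ j → j ≤ r ∸ 1 → level (w j) ≡ j
      w-level = path-level w0 w-arcs w-end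

      u≢w : ∀ t → 1 ≤ t → t ≤ r ∸ 1 → u t ≢ w t
      u≢w t 1≤t t≤ ut≡wt = <⇒≢ 1≤t (trans (sym level-v) (trans (cong level (sym wt≡v)) (w-level t t≤)))
        where
        wt≡v : w t ≡ v
        wt≡v = meets-u⇒≡v t t (≤-trans t≤ (m∸n≤m r 1)) t≤ (sym ut≡wt)

      open TwoPaths M≡r w w-level u≢w

      all-expected : ∀ {y} → 2 ≤ level y → y ∈ expected (level y)
      all-expected {y} 2≤level with y ∈? expected (level y)
      ... | yes y∈ = y∈
      ... | no  y∉ = contradiction (level-unique (others y (proj₁ (off-paths y∉)) (proj₂ (off-paths y∉))))
                                   (>⇒≢ 2≤level)

      returns-sum≡0 : rangeSum c 1 M ≡ 0
      returns-sum≡0 = rangeSum-zero M c≡0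
        where
        c≡0 : ∀ {i} → i ∈[ 1 ,+ M ⟩ → c i ≡ 0
        c≡0 {i} (1≤i , s≤s i≤M) = cong (pred ∘ finitePart) (back≡1 i 1≤i (subst (i ≤_) M≡r i≤M))

  module NotReturning {i} (i∈ : i ∈[ 1 ,+ M ⟩) (back≡∞ : d (u i) v ≡ ∞) where

    total≡∞ : sumOut D d v +∞ sum1to M (λ i → pred∞ (d (u i) v)) ≡ ∞
    total≡∞ = trans (cong (sumOut D d v +∞_) (sum1to-∞ M i∈ (cong pred∞ back≡∞))) (x+∞∞≡∞ _)

    not-extremal : ¬ Extremal
    not-extremal (M≡r , _ , _ , _ , _ , _ , back≡1 , _)
      with trans (sym back≡∞) (back≡1 i (proj₁ i∈) (subst (i ≤_) M≡r (≤-pred (proj₂ i∈))))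
    ... | ()

proposition1 : (D : Digraph) (d : V D → V D → ℕ∞) → IsDistanceFunction D d →
    (v : V D) (r r' : ℕ) → 3 ≤ r → r ≤ r' → OutEccentricity D d v r' →
    (u : ℕ → V D) → u 0 ≡ v → IsDirPath D u r' → d v (u r') ≡ fin r' →
    (∀ i → r' ∸ r + 1 ≤ i → i ≤ r' →
      ∃ (λ x → (d v x <∞ (d v (u i) +∞ d (u i) x)) × (fin r ≤∞ (d (u i) v +∞ d v x)))) →
    (fin ((r ∸ 1) * (r ∸ 1)) ≤∞ (sumOut D d v +∞ sum1to r' (λ i → pred∞ (d (u i) v))))
    ×
    ((sumOut D d v +∞ sum1to r' (λ i → pred∞ (d (u i) v)) ≡ fin ((r ∸ 1) * (r ∸ 1)))
     ⇔
     ((r' ≡ r) ×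
      ∃ (λ (w : ℕ → V D) →
        (w 0 ≡ v) × IsDirPath D w (r ∸ 1) × (d v (w (r ∸ 1)) ≡ fin (r ∸ 1)) ×
        (∀ i j → i ≤ r → j ≤ r ∸ 1 → w j ≡ u i → w j ≡ v) ×
        (∀ i → 1 ≤ i → i ≤ r → d (u i) v ≡ fin 1) ×
        (∀ y → (∀ i → i ≤ r → ¬ y ≡ u i) → (∀ j → j ≤ r ∸ 1 → ¬ y ≡ w j) →
          d v y ≡ fin 1))))
proposition1 D d isDist v r r' 3≤r r≤r' ecc u u0 upath du witness
  with finite-or-∞ (λ i → d (u i) v) 1 r'
... | inj₁ returns =
  subst (fin ((r ∸ 1) * (r ∸ 1)) ≤∞_) (sym total≡) (fin≤fin square≤total) ,
  mk⇔ (λ sum≡ → total-extremal (fin-injective (trans (sym total≡) sum≡)))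
      (λ extremal → trans total≡ (cong fin (extremal-total extremal)))
  where
  open Configuration D d isDist v r r' 3≤r r≤r' ecc u u0 upath du witness
  open Returning returns
... | inj₂ (i , i∈ , back≡∞) =
  subst (fin ((r ∸ 1) * (r ∸ 1)) ≤∞_) (sym total≡∞) (_ ≤∞∞) ,
  mk⇔ (λ sum≡ → case trans (sym total≡∞) sum≡ of λ ()) (λ extremal → contradiction extremal not-extremal)
  where
  open Configuration D d isDist v r r' 3≤r r≤r' ecc u u0 upath du witness
  open NotReturning i∈ back≡∞
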